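{- Let $\mathcal{L}$ be a finite distributive lattice with set of join-irreducibles $J$ (convention below). Then $n(\mathcal{L}) \leq (|\mathcal{L}|-|J|)\,|\mathcal{L}|/2$.
   Context: $n(\mathcal{L})$ is the number of unordered pairs of non-comparable elements of $\mathcal{L}$. $J$ is the set of join-irreducible elements of $\mathcal{L}$, with the minimum $\hat0$ counted as join-irreducible, so $|J|$ equals the number of elements in a maximal chain of $\mathcal{L}$. -}

module Defs where

open import Data.Nat using (ℕ; _<_; _<?_)
open import Data.Fin using (Fin; toℕ)
open import Data.Fin.Properties using (_≟_; all?)
open import Data.List using (List; length; filter; allFin; cartesianProduct)
open import Data.Product using (_×_; _,_)
open import Data.Sum using (_⊎_)
open import Relation.Nullary using (¬_; Dec)
open import Relation.Nullary.Decidable using (_×-dec_; _⊎-dec_; ¬?; _→-dec_)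
open import Relation.Unary using (Pred; Decidable)
open import Relation.Binary.PropositionalEquality using (_≡_)
open import Algebra.Core using (Op₂)
import Algebra.Lattice.Structures as LS

-- A finite distributive lattice, presented (up to isomorphism) on the
-- carrier Fin size, with propositional equality.
record FinDistLattice : Set where
  field
    size : ℕ
    _∨_  : Op₂ (Fin size)
    _∧_  : Op₂ (Fin size)
    isDistributiveLattice : LS.IsDistributiveLattice {A = Fin size} _≡_ _∨_ _∧_

  Elt : Set
  Elt = Fin size

  _≤L_ : Elt → Elt → Set
  x ≤L y = (x ∧ y) ≡ x

  _≤L?_ : (x y : Elt) → Dec (x ≤L y)
  x ≤L? y = (x ∧ y) ≟ x

  -- join-irreducible; the minimum is counted as join-irreducible
  -- (a ∨ b = 0 forces a = b = 0, so the minimum satisfies this condition)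
  IsJoinIrreducible : Elt → Set
  IsJoinIrreducible j = ∀ a b → (a ∨ b) ≡ j → (a ≡ j) ⊎ (b ≡ j)

  isJoinIrreducible? : (j : Elt) → Dec (IsJoinIrreducible j)
  isJoinIrreducible? j =
    all? λ a → all? λ b → jiCond? a b
    where
    jiCond? : (a b : Elt) → Dec ((a ∨ b) ≡ j → (a ≡ j) ⊎ (b ≡ j))
    jiCond? a b = ((a ∨ b) ≟ j) →-dec ((a ≟ j) ⊎-dec (b ≟ j))

  numJoinIrreducibles : ℕ
  numJoinIrreducibles = length (filter isJoinIrreducible? (allFin size))

  -- unordered pair {x,y} of non-comparable elements, represented once by x < y
  IncomparablePair : Pred (Elt × Elt) _
  IncomparablePair (x , y) = (toℕ x < toℕ y) × (¬ (x ≤L y)) × (¬ (y ≤L x))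

  incomparablePair? : Decidable IncomparablePair
  incomparablePair? (x , y) = (toℕ x <? toℕ y) ×-dec (¬? (x ≤L? y) ×-dec ¬? (y ≤L? x))

  numIncomparablePairs : ℕ
  numIncomparablePairs =
    length (filter incomparablePair? (cartesianProduct (allFin size) (allFin size)))

-- For a fixed x and a join-irreducible j, send j to itself if j ≤ x and to
-- x ∨ j otherwise.  Each image is comparable with x, and distributivity makes
-- the map injective on join-irreducibles: if j ≰ x and x ∨ j = x ∨ j', then
-- j = (j ∧ x) ∨ (j ∧ j') forces j ≤ j'.  So every x is comparable with at
-- least |J| elements and incomparable with at most |L| - |J|; summing over x
-- counts every incomparable pair twice.
module Submission where

open import Defs
open import Data.Nat using (_*_; _∸_; _≤_; _+_; suc; z≤n; s≤s)
open import Data.Nat.Properties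
  using (≤-trans; ≤-reflexive; +-mono-≤; +-monoʳ-≤; +-suc; +-identityʳ; *-comm;
         +-comm; <-asym; m+n≤o⇒m≤o∸n; module ≤-Reasoning)
open import Data.List using (List; []; _∷_; _++_; length; map; filter; allFin; cartesianProduct)
open import Data.List.Properties using (length-++; length-map; length-++-sucʳ; length-tabulate; filter-++)
import Data.List.Relation.Unary.All as All
open import Data.List.Relation.Unary.Any using (here; there)
open import Data.List.Relation.Unary.Unique.Propositional using (Unique; _∷_)
open import Data.List.Relation.Unary.Unique.Propositional.Properties
  using (++⁺; map⁺; filter⁺; cartesianProduct⁺; allFin⁺)
open import Data.List.Relation.Binary.Disjoint.Propositional using (Disjoint)
open import Data.List.Membership.Propositional using (_∈_)
open import Data.List.Membership.Propositional.Properties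
  using (∈-∃++; ∈-++⁺ˡ; ∈-++⁺ʳ; ∈-++⁻; ∈-map⁻; ∈-filter⁺; ∈-filter⁻;
         ∈-cartesianProduct⁺; ∈-cartesianProduct⁻; ∈-allFin)
open import Data.Product using (_×_; _,_; proj₂; swap; uncurry)
open import Data.Sum using (_⊎_; inj₁; inj₂) renaming (swap to ⊎-swap)
open import Data.Empty using (⊥-elim)
open import Function using (id; _∘_)
open import Relation.Nullary using (¬_; yes; no)
open import Relation.Nullary.Decidable using (_⊎-dec_; ¬?)
open import Relation.Unary using (Pred; Decidable; ∁)
open import Relation.Unary.Properties using (∁?)
open import Relation.Binary.PropositionalEquality
  using (_≡_; _≢_; refl; sym; trans; cong; subst; module ≡-Reasoning)
import Algebra.Lattice.Structures as LS

module _ {a} {A : Set a} where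

  ∈-++-skip : ∀ as {bs} {v w : A} → w ∈ as ++ v ∷ bs → w ≢ v → w ∈ as ++ bs
  ∈-++-skip as w∈ w≢v with ∈-++⁻ as w∈
  ... | inj₁ w∈as          = ∈-++⁺ˡ w∈as
  ... | inj₂ (here refl)   = ⊥-elim (w≢v refl)
  ... | inj₂ (there w∈bs)  = ∈-++⁺ʳ as w∈bs

  module _ {p} {P : Pred A p} (P? : Decidable P) where

    length-filter-∁ : ∀ xs → length (filter P? xs) + length (filter (∁? P?) xs) ≡ length xs
    length-filter-∁ [] = refl
    length-filter-∁ (x ∷ xs) with P? x
    ... | yes _ = cong suc (length-filter-∁ xs)
    ... | no _  = trans (+-suc _ _) (cong suc (length-filter-∁ xs))

module _ {a b p} {A : Set a} {B : Set b} {P : Pred B p} (P? : Decidable P) where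

  length-filter-map : (f : A → B) (xs : List A) →
    length (filter P? (map f xs)) ≡ length (filter (P? ∘ f) xs)
  length-filter-map f [] = refl
  length-filter-map f (x ∷ xs) with P? (f x)
  ... | yes _ = cong suc (length-filter-map f xs)
  ... | no _  = length-filter-map f xs

module _ {a b} {A : Set a} {B : Set b} where

  length-≤-injection : (f : A → B) {xs : List A} {ys : List B} → Unique xs →
    (∀ {u} → u ∈ xs → f u ∈ ys) →
    (∀ {u v} → u ∈ xs → v ∈ xs → f u ≡ f v → u ≡ v) →
    length xs ≤ length ys
  length-≤-injection f {[]} _ _ _ = z≤n
  length-≤-injection f {x ∷ xs} (x∉xs ∷ uniq) into inj
    with as , bs , refl ← ∈-∃++ (into (here refl)) =
    ≤-trans (s≤s (length-≤-injection f uniq into′ λ u∈ v∈ → inj (there u∈) (there v∈)))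
            (≤-reflexive (sym (length-++-sucʳ as (f x) bs)))
    where
    into′ : ∀ {u} → u ∈ xs → f u ∈ as ++ bs
    into′ u∈ = ∈-++-skip as (into (there u∈))
      λ fu≡fx → All.lookup x∉xs u∈ (sym (inj (there u∈) (here refl) fu≡fx))

  module _ {p} {P : Pred (A × B) p} (P? : Decidable P) where

    length-filter-cartesianProduct-≤ : ∀ xs ys {c} →
      (∀ x → length (filter (P? ∘ (x ,_)) ys) ≤ c) →
      length (filter P? (cartesianProduct xs ys)) ≤ length xs * c
    length-filter-cartesianProduct-≤ [] ys rows = z≤n
    length-filter-cartesianProduct-≤ (x ∷ xs) ys {c} rows = begin
      length (filter P? (map (x ,_) ys ++ cartesianProduct xs ys))
        ≡⟨ cong length (filter-++ P? (map (x ,_) ys) _) ⟩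
      length (filter P? (map (x ,_) ys) ++ filter P? (cartesianProduct xs ys))
        ≡⟨ length-++ (filter P? (map (x ,_) ys)) ⟩
      length (filter P? (map (x ,_) ys)) + length (filter P? (cartesianProduct xs ys))
        ≤⟨ +-mono-≤ (≤-trans (≤-reflexive (length-filter-map P? (x ,_) ys)) (rows x))
                    (length-filter-cartesianProduct-≤ xs ys rows) ⟩
      c + length xs * c ∎
      where open ≤-Reasoning

module _ {a p q} {A : Set a} {P : Pred (A × A) p} {Q : Pred (A × A) q}
         (P? : Decidable P) (Q? : Decidable Q) where

  twice-asymmetric-pairs-≤-symmetric-pairs : ∀ {xs} → Unique xs →
    (∀ {z} → P z → Q z) → (∀ {z} → Q z → Q (swap z)) → (∀ {z} → P z → ¬ P (swap z)) →
    2 * length (filter P? (cartesianProduct xs xs)) ≤ length (filter Q? (cartesianProduct xs xs))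
  twice-asymmetric-pairs-≤-symmetric-pairs {xs} uniq-xs P⇒Q Q-sym P-asym = begin
    2 * length ps               ≡⟨ cong (length ps +_) (+-identityʳ (length ps)) ⟩
    length ps + length ps       ≡⟨ cong (length ps +_) (sym (length-map swap ps)) ⟩
    length ps + length ps′      ≡⟨ sym (length-++ ps) ⟩
    length (ps ++ ps′)          ≤⟨ length-≤-injection id uniq into (λ _ _ → id) ⟩
    length (filter Q? pairs)    ∎
    where
    open ≤-Reasoning
    pairs = cartesianProduct xs xs
    ps    = filter P? pairs
    ps′   = map swap ps

    uniq-ps : Unique ps
    uniq-ps = filter⁺ P? (cartesianProduct⁺ uniq-xs uniq-xs)

    disjoint : Disjoint ps ps′
    disjoint (z∈ps , z∈ps′) with w , w∈ps , refl ← ∈-map⁻ swap z∈ps′ =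
      P-asym (proj₂ (∈-filter⁻ P? {xs = pairs} w∈ps)) (proj₂ (∈-filter⁻ P? {xs = pairs} z∈ps))

    uniq : Unique (ps ++ ps′)
    uniq = ++⁺ uniq-ps (map⁺ (cong swap) uniq-ps) disjoint

    swap-∈-pairs : ∀ {z} → z ∈ pairs → swap z ∈ pairs
    swap-∈-pairs z∈ = let x∈ , y∈ = ∈-cartesianProduct⁻ xs xs z∈ in ∈-cartesianProduct⁺ y∈ x∈

    into : ∀ {z} → z ∈ ps ++ ps′ → z ∈ filter Q? pairs
    into {z} z∈ with ∈-++⁻ ps z∈
    ... | inj₁ z∈ps =
      let z∈pairs , Pz = ∈-filter⁻ P? {xs = pairs} z∈ps in ∈-filter⁺ Q? z∈pairs (P⇒Q Pz)
    ... | inj₂ z∈ps′ with w , w∈ps , refl ← ∈-map⁻ swap z∈ps′ =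
      let w∈pairs , Pw = ∈-filter⁻ P? {xs = pairs} w∈ps in
      ∈-filter⁺ Q? (swap-∈-pairs w∈pairs) (Q-sym (P⇒Q Pw))

module Lattice (L : FinDistLattice) where
  open FinDistLattice L
  open LS.IsDistributiveLattice isDistributiveLattice
    using (∨-comm; ∧-comm; ∧-assoc; ∧-absorbs-∨; ∧-distribˡ-∨)

  ≤L-antisym : ∀ {x y} → x ≤L y → y ≤L x → x ≡ y
  ≤L-antisym {x} {y} x≤y y≤x = trans (sym x≤y) (trans (∧-comm x y) y≤x)

  ≤L-trans : ∀ {x y z} → x ≤L y → y ≤L z → x ≤L z
  ≤L-trans {x} {y} {z} x≤y y≤z = begin
    x ∧ z        ≡⟨ cong (_∧ z) (sym x≤y) ⟩
    (x ∧ y) ∧ z  ≡⟨ ∧-assoc x y z ⟩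
    x ∧ (y ∧ z)  ≡⟨ cong (x ∧_) y≤z ⟩
    x ∧ y        ≡⟨ x≤y ⟩
    x            ∎
    where open ≡-Reasoning

  y≤x∨y : ∀ x y → y ≤L (x ∨ y)
  y≤x∨y x y = trans (cong (y ∧_) (∨-comm x y)) (∧-absorbs-∨ y x)

  Comparable : Elt → Elt → Set
  Comparable x y = x ≤L y ⊎ y ≤L x

  comparable? : ∀ x → Decidable (Comparable x)
  comparable? x y = (x ≤L? y) ⊎-dec (y ≤L? x)

  joinIrreducible-≤-cancel : ∀ {x j j′} → IsJoinIrreducible j → ¬ j ≤L x →
    (x ∨ j) ≡ (x ∨ j′) → j ≤L j′
  joinIrreducible-≤-cancel {x} {j} {j′} ji j≰x x∨j≡x∨j′ with ji (j ∧ x) (j ∧ j′) j∧x∨j∧j′≡j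
    where
    j∧x∨j∧j′≡j : ((j ∧ x) ∨ (j ∧ j′)) ≡ j
    j∧x∨j∧j′≡j = begin
      (j ∧ x) ∨ (j ∧ j′)  ≡⟨ sym (∧-distribˡ-∨ j x j′) ⟩
      j ∧ (x ∨ j′)        ≡⟨ cong (j ∧_) (sym x∨j≡x∨j′) ⟩
      j ∧ (x ∨ j)         ≡⟨ y≤x∨y x j ⟩
      j                   ∎
      where open ≡-Reasoning
  ... | inj₁ j≤x  = ⊥-elim (j≰x j≤x)
  ... | inj₂ j≤j′ = j≤j′

  partner : Elt → Elt → Elt
  partner x j with j ≤L? x
  ... | yes _ = j
  ... | no _  = x ∨ j

  partner-comparable : ∀ x j → Comparable x (partner x j)
  partner-comparable x j with j ≤L? x
  ... | yes j≤x = inj₂ j≤x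
  ... | no _    = inj₁ (∧-absorbs-∨ x j)

  partner-injective : ∀ x {j j′} → IsJoinIrreducible j → IsJoinIrreducible j′ →
    partner x j ≡ partner x j′ → j ≡ j′
  partner-injective x {j} {j′} ji ji′ eq with j ≤L? x | j′ ≤L? x
  ... | yes _   | yes _    = eq
  ... | yes j≤x | no j′≰x  = ⊥-elim (j′≰x (≤L-trans (y≤x∨y x j′) (subst (_≤L x) eq j≤x)))
  ... | no j≰x  | yes j′≤x = ⊥-elim (j≰x (≤L-trans (y≤x∨y x j) (subst (_≤L x) (sym eq) j′≤x)))
  ... | no j≰x  | no j′≰x  =
    ≤L-antisym (joinIrreducible-≤-cancel ji j≰x eq) (joinIrreducible-≤-cancel ji′ j′≰x (sym eq))

  elements : List Elt
  elements = allFin size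

  length-elements : length elements ≡ size
  length-elements = length-tabulate id

  numJoinIrreducibles-≤-length-comparable : ∀ x →
    numJoinIrreducibles ≤ length (filter (comparable? x) elements)
  numJoinIrreducibles-≤-length-comparable x =
    length-≤-injection (partner x) (filter⁺ isJoinIrreducible? (allFin⁺ size))
      (λ {j} _ → ∈-filter⁺ (comparable? x) (∈-allFin (partner x j)) (partner-comparable x j))
      (λ j∈ j′∈ → partner-injective x (joinIrreducible j∈) (joinIrreducible j′∈))
    where
    joinIrreducible : ∀ {j} → j ∈ filter isJoinIrreducible? elements → IsJoinIrreducible j
    joinIrreducible = proj₂ ∘ ∈-filter⁻ isJoinIrreducible? {xs = elements}

  Incomparable : Pred (Elt × Elt) _
  Incomparable = ∁ (uncurry Comparable)

  incomparable? : Decidable Incomparable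
  incomparable? (x , y) = ∁? (comparable? x) y

  length-incomparable-≤ : ∀ x →
    length (filter (incomparable? ∘ (x ,_)) elements) ≤ size ∸ numJoinIrreducibles
  length-incomparable-≤ x = m+n≤o⇒m≤o∸n (length incomparables) (begin
    length incomparables + numJoinIrreducibles
      ≤⟨ +-monoʳ-≤ (length incomparables) (numJoinIrreducibles-≤-length-comparable x) ⟩
    length incomparables + length comparables
      ≡⟨ +-comm (length incomparables) (length comparables) ⟩
    length comparables + length incomparables
      ≡⟨ length-filter-∁ (comparable? x) elements ⟩
    length elements
      ≡⟨ length-elements ⟩
    size ∎)
    where
    open ≤-Reasoning
    comparables   = filter (comparable? x) elements
    incomparables = filter (incomparable? ∘ (x ,_)) elements

  incomparablePair⇒incomparable : ∀ {p} → IncomparablePair p → Incomparable p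
  incomparablePair⇒incomparable (_ , x≰y , _) (inj₁ x≤y) = x≰y x≤y
  incomparablePair⇒incomparable (_ , _ , y≰x) (inj₂ y≤x) = y≰x y≤x

  incomparable-sym : ∀ {p} → Incomparable p → Incomparable (swap p)
  incomparable-sym x∦y y≤x⊎x≤y = x∦y (⊎-swap y≤x⊎x≤y)

  incomparablePair-asym : ∀ {p} → IncomparablePair p → ¬ IncomparablePair (swap p)
  incomparablePair-asym (x<y , _) (y<x , _) = <-asym x<y y<x

mainTheorem4 : (L : FinDistLattice) →
    let open FinDistLattice L in
    2 * numIncomparablePairs ≤ (size ∸ numJoinIrreducibles) * size
mainTheorem4 L = begin
  2 * numIncomparablePairs
    ≤⟨ twice-asymmetric-pairs-≤-symmetric-pairs incomparablePair? incomparable? (allFin⁺ size)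
         incomparablePair⇒incomparable incomparable-sym incomparablePair-asym ⟩
  length (filter incomparable? (cartesianProduct elements elements))
    ≤⟨ length-filter-cartesianProduct-≤ incomparable? elements elements length-incomparable-≤ ⟩
  length elements * (size ∸ numJoinIrreducibles)
    ≡⟨ cong (_* (size ∸ numJoinIrreducibles)) length-elements ⟩
  size * (size ∸ numJoinIrreducibles)
    ≡⟨ *-comm size _ ⟩
  (size ∸ numJoinIrreducibles) * size ∎
  where
  open FinDistLattice L
  open Lattice L
  open ≤-Reasoning
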